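{- Let $M$ be an $m^2\times m^2$ symmetric positive definite permutation constraint matrix and $\mathbb{M}=\{N\ \text{real symmetric positive definite}:\ Aut(N)=Aut(M)\}$. Let $M^{(0)}=M$ and $M^{(i)}=SymSub(SymSqr(M^{(i-1)}))$ for $i\ge1$, let $s$ be the iteration at which the stable pattern is reached, i.e. $\Pi(M^{(s+j)})=\Pi(M^{(s)})$ for all $j\ge1$, and let $M^*$ be a symmetric positive definite matrix with $\Pi(M^*)=\Pi(M^{(s)})$. Then $M^{(i)}\in\mathbb{M}$ for all $i\ge1$, and $M^*\in\mathbb{M}$.
   Context: For a square matrix $X$, $Aut(X)$ is the group of permutation matrices $P$ with $PXP^T=X$; $\Pi(X)$ is the partition of locations $(i,j)$ with $(i,j),(r,s)$ in the same cell iff $X_{i,j}=X_{r,s}$. A permutation constraint matrix is $D+R$ with $D=\mathrm{diag}(\mathrm{vec}(C))$ for an $m\times m$ matrix $C$ of positive integers whose diagonal entries are all different from its off-diagonal entries and all at least $3$ ($\mathrm{vec}$ = column-major listing), and $R=I_m\otimes(J_m-I_m)+(J_m-I_m)\otimes(2I_m)$ ($J_m$ all-ones, $\otimes$ Kronecker). Canonical inner product string of $X$ at $(i,j)$: terms $(X_{i,k},X_{k,j})$, $k=1,\dots,m^2$; list first the terms involving a diagonal entry (if $i\ne j$: $(X_{i,i},X_{i,j})$ then $(X_{i,j},X_{j,j})$; if $i=j$: $(X_{i,i},X_{i,i})$), then the rest sorted lexicographically. $SymSqr(X)$ has $(i,j)$ and $(j,i)$ entries equal to the lexicographically lesser of the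 canonical strings at $(i,j)$ and $(j,i)$. $SymSub$: given an $m^2\times m^2$ array of strings with $n_1$ distinct off-diagonal strings and $n_2$ distinct diagonal strings (no string occurring both on and off the diagonal), sort the off-diagonal strings lexicographically and assign them $1,\dots,n_1$ in order, and sort the diagonal strings lexicographically and assign them $m^2n_1+1,\dots,m^2n_1+n_2$ in order. -}

module Defs where

open import Level using (0ℓ)
open import Data.Nat as ℕ using (ℕ; zero; suc; _*_)
open import Data.Nat.Properties as ℕP using ()
open import Data.Bool using (Bool; true; false; if_then_else_; _∧_; _∨_)
open import Data.Fin using (Fin; quotRem; _≟_)
open import Data.Fin.Permutation using (Permutation′; _⟨$⟩ʳ_)
open import Data.List using (List; []; _∷_; length; filter; deduplicate; allFin; concatMap; map)
import Data.List.Properties as LP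
import Data.Product.Properties as PP
open import Data.Product using (_×_; _,_; proj₁; proj₂; Σ; ∃)
open import Data.Sum using (_⊎_)
open import Relation.Nullary using (¬_; ¬?; does)
open import Relation.Nullary.Decidable using (T?)
open import Relation.Binary.PropositionalEquality using (_≡_; _≢_)
open import Relation.Binary.Structures using (IsStrictTotalOrder)
open import Algebra.Structures using (IsCommutativeRing)
open import Function.Bundles using (_⇔_)

-- The real numbers, given axiomatically as a complete ordered field
-- (any two such are isomorphic, so quantifying over them = talking about ℝ).

record RealField : Set₁ where
  infixl 6 _+_
  infixl 7 _·_
  infix 4 _<_ _≤_
  field
    Carrier : Set
    _+_ _·_ : Carrier → Carrier → Carrier
    -_      : Carrier → Carrier
    0r 1r   : Carrier
    _<_     : Carrier → Carrier → Set
    isCommutativeRing : IsCommutativeRing _≡_ _+_ _·_ -_ 0r 1r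
    0≢1     : 0r ≢ 1r
    inverse : ∀ x → x ≢ 0r → ∃ λ y → x · y ≡ 1r
    isStrictTotalOrder : IsStrictTotalOrder _≡_ _<_
    +-mono-< : ∀ {x y} z → x < y → x + z < y + z
    ·-pos    : ∀ {x y} → 0r < x → 0r < y → 0r < x · y
  _≤_ : Carrier → Carrier → Set
  x ≤ y = x < y ⊎ x ≡ y
  field
    complete : (S : Carrier → Set) → ∃ S → (∃ λ b → ∀ x → S x → x ≤ b) →
               ∃ λ s → (∀ x → S x → x ≤ s) × (∀ b → (∀ x → S x → x ≤ b) → s ≤ b)

Mat : Set → ℕ → Set
Mat A n = Fin n → Fin n → A

Symmetric : ∀ {A n} → Mat A n → Set
Symmetric X = ∀ i j → X i j ≡ X j i

-- Aut(X): permutations σ (matrix P) with P X Pᵀ = X, i.e. X (σ i) (σ j) = X i j.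
IsAut : ∀ {A n} → Permutation′ n → Mat A n → Set
IsAut σ X = ∀ i j → X (σ ⟨$⟩ʳ i) (σ ⟨$⟩ʳ j) ≡ X i j

SameAut : ∀ {A B n} → Mat A n → Mat B n → Set
SameAut X Y = ∀ σ → IsAut σ X ⇔ IsAut σ Y

-- Π(X) = Π(Y): the partitions of locations by equal entries coincide.
SamePattern : ∀ {A B n} → Mat A n → Mat B n → Set
SamePattern X Y = ∀ i j r s → (X i j ≡ X r s) ⇔ (Y i j ≡ Y r s)

module RealMatrices (ℝ : RealField) where
  open RealField ℝ

  fromℕ : ℕ → Carrier
  fromℕ zero    = 0r
  fromℕ (suc k) = 1r + fromℕ k

  Σ[_] : ∀ {n} → (Fin n → Carrier) → Carrier
  Σ[_] {zero}  f = 0r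
  Σ[_] {suc n} f = f Fin.zero + Σ[ (λ i → f (Fin.suc i)) ]
    where import Data.Fin as Fin

  quad : ∀ {n} → Mat Carrier n → (Fin n → Carrier) → Carrier
  quad N x = Σ[ (λ i → Σ[ (λ j → x i · N i j · x j) ]) ]

  PositiveDefinite : ∀ {n} → Mat Carrier n → Set
  PositiveDefinite {n} N = ∀ (x : Fin n → Carrier) → ¬ (∀ i → x i ≡ 0r) → 0r < quad N x

  SymPD : ∀ {n} → Mat Carrier n → Set
  SymPD N = Symmetric N × PositiveDefinite N

  real : ∀ {n} → Mat ℕ n → Mat Carrier n
  real X i j = fromℕ (X i j)

  In𝕄 : ∀ {n} → Mat ℕ n → Mat Carrier n → Set
  In𝕄 M N = SymPD N × SameAut N (real M)

-- index p of Fin (m*m) ↦ (p mod m , p div m)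
split : ∀ {m} → Fin (m * m) → Fin m × Fin m
split {m} p = quotRem {m} m p

ValidC : ∀ {m} → Mat ℕ m → Set
ValidC {m} C = (∀ i j → 1 ℕ.≤ C i j)
             × (∀ i → 3 ℕ.≤ C i i)
             × (∀ i j k → j ≢ k → C i i ≢ C j k)

isEq : ∀ {m} → Fin m → Fin m → Bool
isEq a b = does (a ≟ b)

-- D = diag(vec C) (column major: vec(C)_p = C (p mod m) (p div m))
-- R = I ⊗ (J - I) + (J - I) ⊗ (2 I)   (block index = p div m, inner index = p mod m)
PCM : ∀ {m} → Mat ℕ m → Mat ℕ (m * m)
PCM C p q with split p | split q
... | (a , b) | (a' , b') =
  (if isEq p q then C a b else 0)
  ℕ.+ (if isEq b b' ∧ Data.Bool.not (isEq a a') then 1 else 0)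
  ℕ.+ (if Data.Bool.not (isEq b b') ∧ isEq a a' then 2 else 0)
  where import Data.Bool

Str : Set
Str = List (ℕ × ℕ)

ltPair : ℕ × ℕ → ℕ × ℕ → Bool
ltPair (a , b) (c , d) = (a ℕ.<ᵇ c) ∨ ((a ℕ.≡ᵇ c) ∧ (b ℕ.<ᵇ d))

ltStr : Str → Str → Bool
ltStr []      []      = false
ltStr []      (_ ∷ _) = true
ltStr (_ ∷ _) []      = false
ltStr (x ∷ xs) (y ∷ ys) = ltPair x y ∨ ((ℕ._≡ᵇ_ (proj₁ x) (proj₁ y) ∧ ℕ._≡ᵇ_ (proj₂ x) (proj₂ y)) ∧ ltStr xs ys)

insertP : ℕ × ℕ → List (ℕ × ℕ) → List (ℕ × ℕ)
insertP x [] = x ∷ []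
insertP x (y ∷ ys) = if ltPair y x then y ∷ insertP x ys else x ∷ y ∷ ys

sortP : List (ℕ × ℕ) → List (ℕ × ℕ)
sortP []       = []
sortP (x ∷ xs) = insertP x (sortP xs)

canon : ∀ {n} → Mat ℕ n → Fin n → Fin n → Str
canon {n} X i j with i ≟ j
... | Relation.Nullary.yes _ =
  (X i i , X i i) ∷ sortP (map (λ k → (X i k , X k j)) (filter (λ k → ¬? (k ≟ i)) (allFin n)))
  where import Relation.Nullary
... | Relation.Nullary.no _ =
  (X i i , X i j) ∷ (X i j , X j j) ∷
  sortP (map (λ k → (X i k , X k j)) (filter (λ k → ¬? (k ≟ j)) (filter (λ k → ¬? (k ≟ i)) (allFin n))))
  where import Relation.Nullary

minStr : Str → Str → Str
minStr s t = if ltStr t s then t else s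

SymSqr : ∀ {n} → Mat ℕ n → Mat Str n
SymSqr X i j = minStr (canon X i j) (canon X j i)

_≟Str_ : (s t : Str) → Relation.Nullary.Dec (s ≡ t)
_≟Str_ = LP.≡-dec (PP.≡-dec ℕP._≟_ ℕP._≟_)
  where import Relation.Nullary

module _ {n : ℕ} (S : Mat Str n) where
  private
    locs : List (Fin n × Fin n)
    locs = concatMap (λ i → map (λ j → (i , j)) (allFin n)) (allFin n)

  offStrs : List Str
  offStrs = deduplicate _≟Str_
    (map (λ ij → S (proj₁ ij) (proj₂ ij)) (filter (λ ij → ¬? (proj₁ ij ≟ proj₂ ij)) locs))

  diagStrs : List Str
  diagStrs = deduplicate _≟Str_ (map (λ i → S i i) (allFin n))

  -- position (1-based) of s in the lexicographically sorted list of distinct strings L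
  rank : List Str → Str → ℕ
  rank L s = suc (length (filter (λ t → T? (ltStr t s)) L))

  -- off-diagonal strings ↦ 1..n₁ ; diagonal strings ↦ m²n₁+1 .. m²n₁+n₂  (here n = m²)
  SymSub : Mat ℕ n
  SymSub i j with i ≟ j
  ... | Relation.Nullary.yes _ = n * length offStrs ℕ.+ rank diagStrs (S i j)
    where import Relation.Nullary
  ... | Relation.Nullary.no _  = rank offStrs (S i j)
    where import Relation.Nullary

iter : ∀ {n} → Mat ℕ n → ℕ → Mat ℕ n
iter M zero    = M
iter M (suc i) = SymSub (SymSqr (iter M i))

-- SymSqr and SymSub commute with every relabelling σ of the indices that fixes
-- their input (a canonical string sorts its terms, so it depends only on the
-- multiset of terms, which σ permutes); hence Aut(M) ⊆ Aut(M⁽ⁱ⁾). Conversely,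
-- for symmetric X the string at (i , j) begins with a term whose second
-- component is X i j, and SymSub gives distinct strings distinct numbers, so
-- equal entries of M⁽ⁱ⁺¹⁾ sit where M⁽ⁱ⁾ has equal entries: patterns only
-- get finer, and Aut(M⁽ⁱ⁾) ⊆ Aut(M). Positive definiteness comes for free:
-- SymSub numbers off-diagonal strings by 1 … n₁ and diagonal ones above m²n₁,
-- so every iterate is strictly diagonally dominant. A matrix with the pattern
-- of M⁽ˢ⁾ has the automorphisms of M⁽ˢ⁾.

module Submission where

open import Defs
open import Level using (0ℓ)
open import Data.Bool using (true; false; T; not; _∧_; if_then_else_)
open import Data.Bool.Properties using (T-∧; T-∨)
open import Data.Empty using (⊥-elim)
open import Data.Fin using (Fin; zero; suc; _≟_)
open import Data.Fin.Properties using (nonZeroIndex)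
open import Data.Fin.Permutation using (Permutation′; _⟨$⟩ʳ_; _⟨$⟩ˡ_; inverseˡ; inverseʳ)
open import Data.List using (List; []; _∷_; map; filter; allFin; length)
open import Data.List.Membership.Propositional using (_∈_)
open import Data.List.Membership.Propositional.Properties using (∈-allFin; ∈-map⁺; ∈-filter⁺; ∈-deduplicate⁺; ∈-concatMap⁺)
open import Data.List.Membership.Propositional.Properties.WithK using (unique∧set⇒bag)
open import Data.List.Properties using (map-∘; map-cong; filter-≐; filter-notAll; filter-reject)
open import Data.List.Relation.Unary.Any as Any using (Any)
open import Data.List.Relation.Binary.BagAndSetEquality using (∼bag⇒↭)
open import Data.List.Relation.Binary.Lex.Strict using (Lex-<; halt; this; next; <-irreflexive; <-transitive; <-compare)
open import Data.List.Relation.Binary.Permutation.Propositional using (_↭_; ↭-trans; ↭-sym; ↭⇒↭ₛ)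
open import Data.List.Relation.Binary.Permutation.Propositional.Properties using (map⁺; filter-↭)
open import Data.List.Relation.Binary.Pointwise using (Pointwise-≡⇒≡; ≡⇒Pointwise-≡)
open import Data.List.Relation.Unary.Unique.Propositional.Properties as Unique using (allFin⁺)
open import Data.Nat as ℕ using (ℕ; zero; suc)
import Data.Nat.Properties as ℕP
open import Data.Product using (_×_; _,_; proj₁; proj₂)
open import Data.Product.Relation.Binary.Lex.Strict using (×-Lex; ×-transitive; ×-compare)
open import Data.Product.Relation.Binary.Pointwise.NonDependent using (≡×≡⇒≡; ≡⇒≡×≡)
open import Data.Sum using (_⊎_; inj₁; inj₂)
open import Data.Unit using (tt)
open import Function using (_∘_; mk⇔; Equivalence)
open import Function.Properties.Equivalence using () renaming (sym to ⇔-sym; trans to ⇔-trans)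
open import Algebra.Bundles using (CommutativeRing)
open import Relation.Binary using (Rel; Trichotomous; IsStrictTotalOrder; StrictTotalOrder; tri<; tri≈; tri>)
open import Relation.Binary.PropositionalEquality
open import Relation.Nullary using (¬_; yes; no; does; ¬?)
open import Relation.Nullary.Decidable using (T?; dec-true; dec-false)
import Relation.Unary as U

filter-map : ∀ {A B : Set} {P : U.Pred B 0ℓ} (P? : U.Decidable P) (f : A → B) xs →
             filter P? (map f xs) ≡ map f (filter (P? ∘ f) xs)
filter-map P? f []       = refl
filter-map P? f (x ∷ xs) with does (P? (f x))
... | true  = cong (f x ∷_) (filter-map P? f xs)
... | false = filter-map P? f xs

filter-filter-⊆ : ∀ {A : Set} {P Q : U.Pred A 0ℓ} (P? : U.Decidable P) (Q? : U.Decidable Q) →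
                  (∀ x → P x → Q x) → ∀ xs → filter P? (filter Q? xs) ≡ filter P? xs
filter-filter-⊆ P? Q? P⊆Q []       = refl
filter-filter-⊆ P? Q? P⊆Q (x ∷ xs) with Q? x
... | no ¬Qx = trans (filter-filter-⊆ P? Q? P⊆Q xs) (sym (filter-reject P? (¬Qx ∘ P⊆Q x)))
... | yes _ with P? x
...   | yes _ = cong (x ∷_) (filter-filter-⊆ P? Q? P⊆Q xs)
...   | no _  = filter-filter-⊆ P? Q? P⊆Q xs

_<ₚ_ : Rel (ℕ × ℕ) 0ℓ
_<ₚ_ = ×-Lex _≡_ ℕ._<_ ℕ._<_

<ₚ-irrefl : ∀ {x} → ¬ x <ₚ x
<ₚ-irrefl (inj₁ a<a)       = ℕP.<-irrefl refl a<a
<ₚ-irrefl (inj₂ (_ , b<b)) = ℕP.<-irrefl refl b<b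

<ₚ-isStrictTotalOrder : IsStrictTotalOrder _≡_ _<ₚ_
<ₚ-isStrictTotalOrder = record
  { isStrictPartialOrder = record
    { isEquivalence = isEquivalence
    ; irrefl        = λ { refl → <ₚ-irrefl }
    ; trans         = ×-transitive {_<₂_ = ℕ._<_} isEquivalence (resp₂ ℕ._<_) ℕP.<-trans ℕP.<-trans
    ; <-resp-≈      = resp₂ _<ₚ_
    }
  ; compare = compare
  }
  where
  compare : Trichotomous _≡_ _<ₚ_
  compare x y with ×-compare sym ℕP.<-cmp ℕP.<-cmp x y
  ... | tri< x<y x≉y y≮x = tri< x<y (x≉y ∘ ≡⇒≡×≡) y≮x
  ... | tri≈ x≮y x≈y y≮x = tri≈ x≮y (≡×≡⇒≡ x≈y) y≮x
  ... | tri> x≮y x≉y y<x = tri> x≮y (x≉y ∘ ≡⇒≡×≡) y<x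

<ₚ-strictTotalOrder : StrictTotalOrder 0ℓ 0ℓ 0ℓ
<ₚ-strictTotalOrder = record { isStrictTotalOrder = <ₚ-isStrictTotalOrder }

ltPair⇒<ₚ : ∀ x y → T (ltPair x y) → x <ₚ y
ltPair⇒<ₚ (a , b) (c , d) h with Equivalence.to T-∨ h
... | inj₁ a<c = inj₁ (ℕP.<ᵇ⇒< a c a<c)
... | inj₂ q   = let a≡c , b<d = Equivalence.to T-∧ q
                 in inj₂ (ℕP.≡ᵇ⇒≡ a c a≡c , ℕP.<ᵇ⇒< b d b<d)

<ₚ⇒ltPair : ∀ {x y} → x <ₚ y → T (ltPair x y)
<ₚ⇒ltPair (inj₁ a<c)             = Equivalence.from T-∨ (inj₁ (ℕP.<⇒<ᵇ a<c))
<ₚ⇒ltPair {a , _} (inj₂ (refl , b<d)) =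
  Equivalence.from T-∨ (inj₂ (Equivalence.from T-∧ (ℕP.≡⇒≡ᵇ a a refl , ℕP.<⇒<ᵇ b<d)))

module <ₚ = IsStrictTotalOrder <ₚ-isStrictTotalOrder

_<ₛ_ : Rel Str 0ℓ
_<ₛ_ = Lex-< _≡_ _<ₚ_

private
  ≡ᵇ-pair⇒≡ : ∀ (x y : ℕ × ℕ) → T ((proj₁ x ℕ.≡ᵇ proj₁ y) ∧ (proj₂ x ℕ.≡ᵇ proj₂ y)) → x ≡ y
  ≡ᵇ-pair⇒≡ (a , b) (c , d) h =
    let a≡c , b≡d = Equivalence.to T-∧ h in cong₂ _,_ (ℕP.≡ᵇ⇒≡ a c a≡c) (ℕP.≡ᵇ⇒≡ b d b≡d)

  ≡⇒≡ᵇ-pair : ∀ (x : ℕ × ℕ) → T ((proj₁ x ℕ.≡ᵇ proj₁ x) ∧ (proj₂ x ℕ.≡ᵇ proj₂ x))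
  ≡⇒≡ᵇ-pair (a , b) = Equivalence.from T-∧ (ℕP.≡⇒≡ᵇ a a refl , ℕP.≡⇒≡ᵇ b b refl)

ltStr⇒<ₛ : ∀ s t → T (ltStr s t) → s <ₛ t
ltStr⇒<ₛ []      (_ ∷ _) _ = halt
ltStr⇒<ₛ (x ∷ s) (y ∷ t) h with Equivalence.to T-∨ h
... | inj₁ x<y = this (ltPair⇒<ₚ x y x<y)
... | inj₂ q   = let x≡y , s<t = Equivalence.to T-∧ q
                 in next (≡ᵇ-pair⇒≡ x y x≡y) (ltStr⇒<ₛ s t s<t)

<ₛ⇒ltStr : ∀ {s t} → s <ₛ t → T (ltStr s t)
<ₛ⇒ltStr halt                    = tt
<ₛ⇒ltStr (this x<y)              = Equivalence.from T-∨ (inj₁ (<ₚ⇒ltPair x<y))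
<ₛ⇒ltStr {x ∷ _} (next refl s<t) =
  Equivalence.from T-∨ (inj₂ (Equivalence.from T-∧ (≡⇒≡ᵇ-pair x , <ₛ⇒ltStr s<t)))

ltStr-irrefl : ∀ s → ¬ T (ltStr s s)
ltStr-irrefl s = <-irreflexive (λ { refl → <ₚ-irrefl }) (≡⇒Pointwise-≡ refl) ∘ ltStr⇒<ₛ s s

ltStr-trans : ∀ s t u → T (ltStr s t) → T (ltStr t u) → T (ltStr s u)
ltStr-trans s t u s<t t<u = <ₛ⇒ltStr
  (<-transitive isEquivalence (resp₂ _<ₚ_) <ₚ.trans (ltStr⇒<ₛ s t s<t) (ltStr⇒<ₛ t u t<u))

ltStr-asym : ∀ s t → T (ltStr s t) → ¬ T (ltStr t s)
ltStr-asym s t s<t t<s = ltStr-irrefl s (ltStr-trans s t s s<t t<s)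

ltStr-≮∧≯⇒≡ : ∀ s t → ¬ T (ltStr s t) → ¬ T (ltStr t s) → s ≡ t
ltStr-≮∧≯⇒≡ s t s≮t t≮s with <-compare sym <ₚ.compare s t
... | tri< s<t _ _ = ⊥-elim (s≮t (<ₛ⇒ltStr s<t))
... | tri≈ _ s≈t _ = Pointwise-≡⇒≡ s≈t
... | tri> _ _ t<s = ⊥-elim (t≮s (<ₛ⇒ltStr t<s))

open import Relation.Binary.Properties.StrictTotalOrder <ₚ-strictTotalOrder using (decTotalOrder; _≤?_; totalOrder)
open import Data.List.Sort.InsertionSort decTotalOrder using (insert; sort)
open import Data.List.Sort.InsertionSort.Properties decTotalOrder using (sort-↭; sort-↗)
open import Data.List.Relation.Unary.Sorted.TotalOrder.Properties using (↗↭↗⇒≋)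

≤?-ltPair : ∀ x y → does (x ≤? y) ≡ not (ltPair y x)
≤?-ltPair x y with ltPair y x in eq
... | true  = dec-false (x ≤? y) λ { (inj₁ x<y) → <ₚ.asym x<y y<x ; (inj₂ refl) → <ₚ-irrefl y<x }
  where
  y<x : y <ₚ x
  y<x = ltPair⇒<ₚ y x (subst T (sym eq) tt)
... | false = dec-true (x ≤? y) x≤y
  where
  x≤y : x <ₚ y ⊎ x ≡ y
  x≤y with <ₚ.compare x y
  ... | tri< x<y _ _ = inj₁ x<y
  ... | tri≈ _ x≡y _ = inj₂ x≡y
  ... | tri> _ _ y<x = ⊥-elim (subst T eq (<ₚ⇒ltPair y<x))

insertP≡insert : ∀ x xs → insertP x xs ≡ insert x xs
insertP≡insert x []       = refl
insertP≡insert x (y ∷ ys) rewrite ≤?-ltPair x y with ltPair y x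
... | true  = cong (y ∷_) (insertP≡insert x ys)
... | false = refl

sortP≡sort : ∀ xs → sortP xs ≡ sort xs
sortP≡sort []       = refl
sortP≡sort (x ∷ xs) = trans (cong (insertP x) (sortP≡sort xs)) (insertP≡insert x (sort xs))

sortP-↭ : ∀ {xs ys} → xs ↭ ys → sortP xs ≡ sortP ys
sortP-↭ {xs} {ys} xs↭ys = begin
  sortP xs ≡⟨ sortP≡sort xs ⟩
  sort xs  ≡⟨ Pointwise-≡⇒≡ (↗↭↗⇒≋ totalOrder (sort-↗ xs) (sort-↗ ys) (↭⇒↭ₛ sort-xs↭sort-ys)) ⟩
  sort ys  ≡⟨ sortP≡sort ys ⟨
  sortP ys ∎
  where
  open ≡-Reasoning
  sort-xs↭sort-ys : sort xs ↭ sort ys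
  sort-xs↭sort-ys = ↭-trans (sort-↭ xs) (↭-trans xs↭ys (↭-sym (sort-↭ ys)))

-- Relabelling the indices

without : ∀ {n} → Fin n → List (Fin n) → List (Fin n)
without i = filter (λ k → ¬? (k ≟ i))

module _ {n : ℕ} (σ : Permutation′ n) where

  private
    π : Fin n → Fin n
    π = σ ⟨$⟩ʳ_

  permute-injective : ∀ {i j} → π i ≡ π j → i ≡ j
  permute-injective {i} {j} πi≡πj = begin
    i                 ≡⟨ inverseˡ σ ⟨
    σ ⟨$⟩ˡ π i        ≡⟨ cong (σ ⟨$⟩ˡ_) πi≡πj ⟩
    σ ⟨$⟩ˡ π j        ≡⟨ inverseˡ σ ⟩
    j                 ∎
    where open ≡-Reasoning

  allFin-↭ : allFin n ↭ map π (allFin n)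
  allFin-↭ = ∼bag⇒↭ (unique∧set⇒bag (allFin⁺ n) (Unique.map⁺ permute-injective (allFin⁺ n))
    λ {k} → mk⇔ (λ _ → subst (_∈ map π (allFin n)) (inverseʳ σ) (∈-map⁺ π (∈-allFin (σ ⟨$⟩ˡ k))))
                (λ _ → ∈-allFin k))

  without-↭ : ∀ {i xs ys} → xs ↭ map π ys → without (π i) xs ↭ map π (without i ys)
  without-↭ {i} {xs} {ys} xs↭πys =
    subst (without (π i) xs ↭_) (trans (filter-map _ π ys) (cong (map π) (filter-≐ _ _ same ys)))
          (filter-↭ _ xs↭πys)
    where
    same : (λ k → π k ≢ π i) U.≐ (λ k → k ≢ i)
    same = (λ πk≢πi k≡i → πk≢πi (cong π k≡i)) , (λ k≢i πk≡πi → k≢i (permute-injective πk≡πi))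

  module _ (X : Mat ℕ n) (aut : IsAut σ X) where

    terms-↭ : ∀ i j {xs ys} → xs ↭ map π ys →
              map (λ k → (X (π i) k , X k (π j))) xs ↭ map (λ k → (X i k , X k j)) ys
    terms-↭ i j {ys = ys} xs↭πys = subst (_ ↭_) πys≡ys (map⁺ _ xs↭πys)
      where
      πys≡ys : map (λ k → (X (π i) k , X k (π j))) (map π ys) ≡ map (λ k → (X i k , X k j)) ys
      πys≡ys = trans (sym (map-∘ ys)) (map-cong (λ k → cong₂ _,_ (aut i k) (aut k j)) ys)

    canon-equivariant : IsAut σ (canon X)
    canon-equivariant i j with i ≟ j | π i ≟ π j
    ... | yes refl | yes _ = cong₂ _∷_ (cong₂ _,_ (aut i i) (aut i i))
      (sortP-↭ (terms-↭ i i (without-↭ allFin-↭)))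
    ... | no _ | no _ = cong₂ _∷_ (cong₂ _,_ (aut i i) (aut i j)) (cong₂ _∷_ (cong₂ _,_ (aut i j) (aut j j))
      (sortP-↭ (terms-↭ i j (without-↭ (without-↭ allFin-↭)))))
    ... | yes refl | no πi≢πi  = ⊥-elim (πi≢πi refl)
    ... | no i≢j   | yes πi≡πj = ⊥-elim (i≢j (permute-injective πi≡πj))

    SymSqr-equivariant : IsAut σ (SymSqr X)
    SymSqr-equivariant i j = cong₂ minStr (canon-equivariant i j) (canon-equivariant j i)

  SymSub-equivariant : (S : Mat Str n) → IsAut σ S → IsAut σ (SymSub S)
  SymSub-equivariant S aut i j with i ≟ j | π i ≟ π j
  ... | yes refl | yes _     = cong (λ s → n ℕ.* length (offStrs S) ℕ.+ rank S (diagStrs S) s) (aut i i)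
  ... | no _     | no _      = cong (rank S (offStrs S)) (aut i j)
  ... | yes refl | no πi≢πi  = ⊥-elim (πi≢πi refl)
  ... | no i≢j   | yes πi≡πj = ⊥-elim (i≢j (permute-injective πi≡πj))

  iter-equivariant : (M : Mat ℕ n) → IsAut σ M → ∀ k → IsAut σ (iter M k)
  iter-equivariant M aut zero    = aut
  iter-equivariant M aut (suc k) =
    SymSub-equivariant _ (SymSqr-equivariant _ (iter-equivariant M aut k))

-- Symmetry and refinement of patterns

minStr-comm : ∀ s t → minStr s t ≡ minStr t s
minStr-comm s t with ltStr t s in t<s | ltStr s t in s<t
... | true  | true  = ⊥-elim (ltStr-asym s t (subst T (sym s<t) tt) (subst T (sym t<s) tt))
... | true  | false = refl
... | false | true  = refl
... | false | false = ltStr-≮∧≯⇒≡ s t (subst T s<t) (subst T t<s)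

SymSqr-symmetric : ∀ {n} (X : Mat ℕ n) → Symmetric (SymSqr X)
SymSqr-symmetric X i j = minStr-comm (canon X i j) (canon X j i)

SymSub-symmetric : ∀ {n} (S : Mat Str n) → Symmetric S → Symmetric (SymSub S)
SymSub-symmetric S sym-S i j with i ≟ j | j ≟ i
... | yes refl | yes _   = refl
... | no _     | no _    = cong (rank S (offStrs S)) (sym-S i j)
... | yes refl | no i≢i  = ⊥-elim (i≢i refl)
... | no i≢j   | yes j≡i = ⊥-elim (i≢j (sym j≡i))

iter-symmetric : ∀ {n} (M : Mat ℕ n) → Symmetric M → ∀ k → Symmetric (iter M k)
iter-symmetric M sym-M zero    = sym-M
iter-symmetric M sym-M (suc k) = SymSub-symmetric _ (SymSqr-symmetric _)

Refines : ∀ {A B : Set} {n} → Mat A n → Mat B n → Set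
Refines Y X = ∀ i j r s → Y i j ≡ Y r s → X i j ≡ X r s

-- canon X i j starts with the term (X i i , X i j); the value on [] is junk,
-- canonical strings being nonempty.
entry : Str → ℕ
entry []            = 0
entry ((_ , b) ∷ _) = b

entry-canon : ∀ {n} (X : Mat ℕ n) i j → entry (canon X i j) ≡ X i j
entry-canon X i j with i ≟ j
... | yes refl = refl
... | no _     = refl

entry-SymSqr : ∀ {n} (X : Mat ℕ n) → Symmetric X → ∀ i j → entry (SymSqr X i j) ≡ X i j
entry-SymSqr X sym-X i j with ltStr (canon X j i) (canon X i j)
... | true  = trans (entry-canon X j i) (sym-X j i)
... | false = entry-canon X i j

SymSqr-refines : ∀ {n} (X : Mat ℕ n) → Symmetric X → Refines (SymSqr X) X
SymSqr-refines X sym-X i j r s e =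
  trans (sym (entry-SymSqr X sym-X i j)) (trans (cong entry e) (entry-SymSqr X sym-X r s))

module _ {n : ℕ} (S : Mat Str n) where

  open import Data.Nat using (_+_; _*_)

  private
    ltStr? : ∀ s → U.Decidable (λ t → T (ltStr t s))
    ltStr? s t = T? (ltStr t s)

    ∉-below : ∀ {s xs} → s ∈ xs → Any (U.∁ (λ t → T (ltStr t s))) xs
    ∉-below {s} = Any.map λ { refl → ltStr-irrefl s }

  rank-≤-length : ∀ {s L} → s ∈ L → rank S L s ℕ.≤ length L
  rank-≤-length {s} {L} s∈L = filter-notAll (ltStr? s) L (∉-below s∈L)

  rank-mono-< : ∀ {s t L} → s ∈ L → T (ltStr s t) → rank S L s ℕ.< rank S L t
  rank-mono-< {s} {t} {L} s∈L s<t = ℕ.s≤s (begin-strict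
    length (filter (ltStr? s) L)                     ≡⟨ cong length (filter-filter-⊆ (ltStr? s) (ltStr? t) below-t L) ⟨
    length (filter (ltStr? s) (filter (ltStr? t) L)) <⟨ filter-notAll (ltStr? s) _ (∉-below s∈below-t) ⟩
    length (filter (ltStr? t) L)                     ∎)
    where
    open ℕP.≤-Reasoning
    below-t : ∀ u → T (ltStr u s) → T (ltStr u t)
    below-t u u<s = ltStr-trans u s t u<s s<t
    s∈below-t : s ∈ filter (ltStr? t) L
    s∈below-t = ∈-filter⁺ (ltStr? t) s∈L s<t

  rank-injective : ∀ {s t L} → s ∈ L → t ∈ L → rank S L s ≡ rank S L t → s ≡ t
  rank-injective {s} {t} s∈L t∈L e = ltStr-≮∧≯⇒≡ s t
    (λ s<t → ℕP.<-irrefl e (rank-mono-< s∈L s<t))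
    (λ t<s → ℕP.<-irrefl (sym e) (rank-mono-< t∈L t<s))

  ∈-diagStrs : ∀ i → S i i ∈ diagStrs S
  ∈-diagStrs i = ∈-deduplicate⁺ _≟Str_ (∈-map⁺ (λ k → S k k) (∈-allFin i))

  ∈-offStrs : ∀ i j → i ≢ j → S i j ∈ offStrs S
  ∈-offStrs i j i≢j = ∈-deduplicate⁺ _≟Str_ (∈-map⁺ (λ ij → S (proj₁ ij) (proj₂ ij))
    (∈-filter⁺ (λ ij → ¬? (proj₁ ij ≟ proj₂ ij)) (∈-concatMap⁺ (λ k → map (k ,_) (allFin n))
      (Any.map (λ { refl → ∈-map⁺ (i ,_) (∈-allFin j) }) (∈-allFin i))) i≢j))

  private
    L : ℕ
    L = length (offStrs S)

    offDiagonal<diagonal : ∀ {b} → Fin n → b ℕ.≤ L → ∀ a → b ℕ.< n * L + suc a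
    offDiagonal<diagonal i b≤L a =
      ℕP.≤-<-trans (ℕP.≤-trans b≤L (ℕP.m≤n*m L n {{nonZeroIndex i}})) (ℕP.m<m+n (n * L) ℕ.z<s)

  SymSub-offDiagonal-≤ : ∀ i j → i ≢ j → SymSub S i j ℕ.≤ L
  SymSub-offDiagonal-≤ i j i≢j with i ≟ j
  ... | yes i≡j = ⊥-elim (i≢j i≡j)
  ... | no _    = rank-≤-length (∈-offStrs i j i≢j)

  SymSub-diagonal-≥ : ∀ i → n * L + 1 ℕ.≤ SymSub S i i
  SymSub-diagonal-≥ i with i ≟ i
  ... | yes _  = ℕP.+-monoʳ-≤ (n * L) (ℕ.s≤s ℕ.z≤n)
  ... | no i≢i = ⊥-elim (i≢i refl)

  SymSub-refines : Refines (SymSub S) S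
  SymSub-refines i j r s e with i ≟ j | r ≟ s
  ... | yes refl | yes refl = rank-injective (∈-diagStrs i) (∈-diagStrs r) (ℕP.+-cancelˡ-≡ (n * L) _ _ e)
  ... | no i≢j   | no r≢s   = rank-injective (∈-offStrs i j i≢j) (∈-offStrs r s r≢s) e
  ... | yes refl | no r≢s   =
    ⊥-elim (ℕP.<⇒≢ (offDiagonal<diagonal i (rank-≤-length (∈-offStrs r s r≢s)) _) (sym e))
  ... | no i≢j   | yes refl =
    ⊥-elim (ℕP.<⇒≢ (offDiagonal<diagonal i (rank-≤-length (∈-offStrs i j i≢j)) _) e)

Refines⇒IsAut : ∀ {A B : Set} {n} {Y : Mat A n} {X : Mat B n} → Refines Y X →
                ∀ σ → IsAut σ Y → IsAut σ X
Refines⇒IsAut Y⊑X σ aut i j = Y⊑X _ _ i j (aut i j)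

iter-refines : ∀ {n} (M : Mat ℕ n) → Symmetric M → ∀ k → Refines (iter M k) M
iter-refines M sym-M zero    i j r s e = e
iter-refines M sym-M (suc k) i j r s e = iter-refines M sym-M k i j r s
  (SymSqr-refines (iter M k) (iter-symmetric M sym-M k) i j r s (SymSub-refines _ i j r s e))

SamePattern-sym : ∀ {A B : Set} {n} {X : Mat A n} {Y : Mat B n} → SamePattern X Y → SamePattern Y X
SamePattern-sym X≈Y i j r s = ⇔-sym (X≈Y i j r s)

SamePattern⇒SameAut : ∀ {A B : Set} {n} {X : Mat A n} {Y : Mat B n} → SamePattern X Y → SameAut X Y
SamePattern⇒SameAut X≈Y σ = mk⇔ (Refines⇒IsAut (λ i j r s → Equivalence.to (X≈Y i j r s)) σ)
                                 (Refines⇒IsAut (λ i j r s → Equivalence.from (X≈Y i j r s)) σ)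

SameAut-trans : ∀ {A B C : Set} {n} {X : Mat A n} {Y : Mat B n} {Z : Mat C n} →
                SameAut X Y → SameAut Y Z → SameAut X Z
SameAut-trans X~Y Y~Z σ = ⇔-trans (X~Y σ) (Y~Z σ)

iter-sameAut : ∀ {n} (M : Mat ℕ n) → Symmetric M → ∀ k → SameAut (iter M k) M
iter-sameAut M sym-M k σ =
  mk⇔ (Refines⇒IsAut (iter-refines M sym-M k) σ) (λ aut → iter-equivariant σ M aut k)

-- Diagonal dominance

module RealFieldProperties (ℝ : RealField) where

  open RealField ℝ
  open RealMatrices ℝ

  commutativeRing : CommutativeRing 0ℓ 0ℓ
  commutativeRing = record { isCommutativeRing = isCommutativeRing }

  open CommutativeRing commutativeRing
    using (+-assoc; +-comm; +-identityˡ; +-identityʳ; *-identityˡ; zeroˡ; zeroʳ; distribˡ; distribʳ; -‿inverseʳ; commutativeSemiring; ring)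
  open import Algebra.Properties.Ring ring using (-‿distribˡ-*; -‿distribʳ-*; -‿involutive)
  open import Algebra.Solver.Ring.NaturalCoefficients.Default commutativeSemiring using (solve; con; _:+_; _:*_; _:=_)
  private module < = IsStrictTotalOrder isStrictTotalOrder

  ≤-refl : ∀ {x} → x ≤ x
  ≤-refl = inj₂ refl

  <-≤-trans : ∀ {x y z} → x < y → y ≤ z → x < z
  <-≤-trans x<y (inj₁ y<z)  = <.trans x<y y<z
  <-≤-trans x<y (inj₂ refl) = x<y

  +-monoʳ-< : ∀ z {x y} → x < y → z + x < z + y
  +-monoʳ-< z {x} {y} x<y = subst₂ _<_ (+-comm x z) (+-comm y z) (+-mono-< z x<y)

  +-mono-<-≤ : ∀ {a b c d} → a < b → c ≤ d → a + c < b + d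
  +-mono-<-≤ {b = b} {c = c} a<b (inj₁ c<d) = <.trans (+-mono-< c a<b) (+-monoʳ-< b c<d)
  +-mono-<-≤ {c = c}         a<b (inj₂ refl) = +-mono-< c a<b

  +-mono-≤-< : ∀ {a b c d} → a ≤ b → c < d → a + c < b + d
  +-mono-≤-< {a} {b} {c} {d} a≤b c<d =
    subst₂ _<_ (+-comm c a) (+-comm d b) (+-mono-<-≤ c<d a≤b)

  +-mono-≤ : ∀ {a b c d} → a ≤ b → c ≤ d → a + c ≤ b + d
  +-mono-≤ (inj₁ a<b)  c≤d         = inj₁ (+-mono-<-≤ a<b c≤d)
  +-mono-≤ (inj₂ refl) (inj₁ c<d)  = inj₁ (+-monoʳ-< _ c<d)
  +-mono-≤ (inj₂ refl) (inj₂ refl) = ≤-refl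

  +-cancelʳ-≤ : ∀ z {a b} → a + z ≤ b + z → a ≤ b
  +-cancelʳ-≤ z {a} {b} a+z≤b+z = subst₂ _≤_ (cancel a) (cancel b) (+-mono-≤ a+z≤b+z (≤-refl { - z}))
    where
    cancel : ∀ u → (u + z) + - z ≡ u
    cancel u = trans (+-assoc u z (- z)) (trans (cong (u +_) (-‿inverseʳ z)) (+-identityʳ u))

  +-nonneg : ∀ {a b} → 0r ≤ a → 0r ≤ b → 0r ≤ a + b
  +-nonneg {a} {b} 0≤a 0≤b = subst (_≤ a + b) (+-identityʳ 0r) (+-mono-≤ 0≤a 0≤b)

  *-nonneg : ∀ {a b} → 0r ≤ a → 0r ≤ b → 0r ≤ a · b
  *-nonneg     (inj₁ 0<a)  (inj₁ 0<b)  = inj₁ (·-pos 0<a 0<b)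
  *-nonneg {a} (inj₁ _)    (inj₂ refl) = inj₂ (sym (zeroʳ a))
  *-nonneg {b = b} (inj₂ refl) _       = inj₂ (sym (zeroˡ b))

  x+x-pos⇒pos : ∀ {x} → 0r < x + x → 0r < x
  x+x-pos⇒pos {x} 0<x+x with <.compare x 0r
  ... | tri< x<0 _ _ = ⊥-elim (<.asym 0<x+x (subst (x + x <_) (+-identityʳ 0r) (+-mono-<-≤ x<0 (inj₁ x<0))))
  ... | tri≈ _ refl _ = ⊥-elim (<.irrefl (sym (+-identityʳ 0r)) 0<x+x)
  ... | tri> _ _ 0<x = 0<x

  x·x-pos : ∀ {x} → x ≢ 0r → 0r < x · x
  x·x-pos {x} x≢0 with <.compare x 0r
  ... | tri< x<0 _ _ = subst (0r <_) (-x·-x≡x·x) (·-pos 0<-x 0<-x)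
    where
    0<-x : 0r < - x
    0<-x = subst₂ _<_ (-‿inverseʳ x) (+-identityˡ (- x)) (+-mono-< (- x) x<0)
    -x·-x≡x·x : (- x) · (- x) ≡ x · x
    -x·-x≡x·x = trans (sym (-‿distribˡ-* x (- x))) (trans (cong -_ (sym (-‿distribʳ-* x x))) (-‿involutive (x · x)))
  ... | tri≈ _ x≡0 _ = ⊥-elim (x≢0 x≡0)
  ... | tri> _ _ 0<x = ·-pos 0<x 0<x

  x·x-nonneg : ∀ x → 0r ≤ x · x
  x·x-nonneg x with x <.≟ 0r
  ... | yes refl = inj₂ (sym (zeroˡ 0r))
  ... | no x≢0   = inj₁ (x·x-pos x≢0)

  0<1 : 0r < 1r
  0<1 = subst (0r <_) (*-identityˡ 1r) (x·x-pos (0≢1 ∘ sym))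

  fromℕ-+ : ∀ a b → fromℕ (a ℕ.+ b) ≡ fromℕ a + fromℕ b
  fromℕ-+ zero    b = sym (+-identityˡ (fromℕ b))
  fromℕ-+ (suc a) b = trans (cong (1r +_) (fromℕ-+ a b)) (sym (+-assoc 1r (fromℕ a) (fromℕ b)))

  fromℕ-* : ∀ a b → fromℕ (a ℕ.* b) ≡ fromℕ a · fromℕ b
  fromℕ-* zero    b = sym (zeroˡ (fromℕ b))
  fromℕ-* (suc a) b = begin
    fromℕ (b ℕ.+ a ℕ.* b)           ≡⟨ fromℕ-+ b (a ℕ.* b) ⟩
    fromℕ b + fromℕ (a ℕ.* b)       ≡⟨ cong₂ _+_ (sym (*-identityˡ (fromℕ b))) (fromℕ-* a b) ⟩
    1r · fromℕ b + fromℕ a · fromℕ b ≡⟨ distribʳ (fromℕ b) 1r (fromℕ a) ⟨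
    (1r + fromℕ a) · fromℕ b         ∎
    where open ≡-Reasoning

  fromℕ-nonneg : ∀ k → 0r ≤ fromℕ k
  fromℕ-nonneg zero    = ≤-refl
  fromℕ-nonneg (suc k) = +-nonneg (inj₁ 0<1) (fromℕ-nonneg k)

  fromℕ-< : ∀ {a b} → a ℕ.< b → fromℕ a < fromℕ b
  fromℕ-< {a} (ℕ.s≤s {n = b} a≤b) with d , refl ← ℕP.m≤n⇒∃[o]m+o≡n a≤b =
    subst₂ _<_ (+-identityʳ (fromℕ a)) (trans (sym (fromℕ-+ a (suc d))) (cong fromℕ (ℕP.+-suc a d)))
      (+-monoʳ-< (fromℕ a) (subst (_< fromℕ (suc d)) (+-identityʳ 0r) (+-mono-<-≤ 0<1 (fromℕ-nonneg d))))

  fromℕ-injective : ∀ {a b} → fromℕ a ≡ fromℕ b → a ≡ b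
  fromℕ-injective {a} {b} e with ℕP.<-cmp a b
  ... | tri< a<b _ _ = ⊥-elim (<.irrefl e (fromℕ-< a<b))
  ... | tri≈ _ a≡b _ = a≡b
  ... | tri> _ _ b<a = ⊥-elim (<.irrefl (sym e) (fromℕ-< b<a))

  Σ-cong : ∀ {n} {f g : Fin n → Carrier} → (∀ i → f i ≡ g i) → Σ[ f ] ≡ Σ[ g ]
  Σ-cong {zero}  f≗g = refl
  Σ-cong {suc n} f≗g = cong₂ _+_ (f≗g zero) (Σ-cong (f≗g ∘ suc))

  Σ-+ : ∀ {n} (f g : Fin n → Carrier) → Σ[ (λ i → f i + g i) ] ≡ Σ[ f ] + Σ[ g ]
  Σ-+ {zero}  f g = sym (+-identityʳ 0r)
  Σ-+ {suc n} f g = trans (cong (f zero + g zero +_) (Σ-+ (f ∘ suc) (g ∘ suc)))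
    (solve 4 (λ a b c d → (a :+ b) :+ (c :+ d) := (a :+ c) :+ (b :+ d)) refl
      (f zero) (g zero) Σ[ f ∘ suc ] Σ[ g ∘ suc ])

  Σ-*ˡ : ∀ {n} c (f : Fin n → Carrier) → Σ[ (λ i → c · f i) ] ≡ c · Σ[ f ]
  Σ-*ˡ {zero}  c f = sym (zeroʳ c)
  Σ-*ˡ {suc n} c f = trans (cong (c · f zero +_) (Σ-*ˡ c (f ∘ suc)))
    (solve 3 (λ c a b → c :* a :+ c :* b := c :* (a :+ b)) refl c (f zero) Σ[ f ∘ suc ])

  Σ-const : ∀ {n} v → Σ[ (λ (_ : Fin n) → v) ] ≡ fromℕ n · v
  Σ-const {zero}  v = sym (zeroˡ v)
  Σ-const {suc n} v = trans (cong (v +_) (Σ-const {n} v))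
    (solve 2 (λ v m → v :+ m :* v := (con 1 :+ m) :* v) refl v (fromℕ n))

  Σ-mono : ∀ {n} {f g : Fin n → Carrier} → (∀ i → f i ≤ g i) → Σ[ f ] ≤ Σ[ g ]
  Σ-mono {zero}  f≤g = ≤-refl
  Σ-mono {suc n} f≤g = +-mono-≤ (f≤g zero) (Σ-mono (f≤g ∘ suc))

  Σ-nonneg : ∀ {n} {f : Fin n → Carrier} → (∀ i → 0r ≤ f i) → 0r ≤ Σ[ f ]
  Σ-nonneg {zero}  0≤f = ≤-refl
  Σ-nonneg {suc n} 0≤f = +-nonneg (0≤f zero) (Σ-nonneg (0≤f ∘ suc))

  δ : ∀ {n} → Fin n → Fin n → Carrier → Carrier
  δ i j v = if does (i ≟ j) then v else 0r

  Σ-δ : ∀ {n} (i : Fin n) v → Σ[ (λ j → δ i j v) ] ≡ v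
  Σ-δ {suc n} zero    v = trans (cong (v +_) (trans (Σ-const {n} 0r) (zeroʳ (fromℕ n)))) (+-identityʳ v)
  Σ-δ {suc n} (suc i) v = trans (+-identityˡ _) (Σ-δ i v)

  Σ-squares-pos : ∀ {n} (x : Fin n → Carrier) → ¬ (∀ i → x i ≡ 0r) → 0r < Σ[ (λ i → x i · x i) ]
  Σ-squares-pos {zero}  x x≢0 = ⊥-elim (x≢0 λ ())
  Σ-squares-pos {suc n} x x≢0 with x zero <.≟ 0r
  ... | yes x₀≡0 = subst (_< Σ[ (λ i → x i · x i) ]) (+-identityˡ 0r) (+-mono-≤-< (x·x-nonneg (x zero))
    (Σ-squares-pos (x ∘ suc) λ x′≡0 → x≢0 λ { zero → x₀≡0 ; (suc i) → x′≡0 i }))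
  ... | no x₀≢0  = subst (_< Σ[ (λ i → x i · x i) ]) (+-identityʳ 0r)
    (+-mono-<-≤ (x·x-pos x₀≢0) (Σ-nonneg λ i → x·x-nonneg (x (suc i))))

  ≤-+ʳ : ∀ a {d} → 0r ≤ d → a ≤ a + d
  ≤-+ʳ a {d} 0≤d = subst (_≤ a + d) (+-identityʳ a) (+-mono-≤ ≤-refl 0≤d)

  -- Writing c = a + d, the left-hand side is a (x + y)² + d (x² + y²).
  offDiagonal-bound : ∀ {a c} x y → a ℕ.≤ c →
    0r ≤ (x · fromℕ a · y + x · fromℕ a · y) + fromℕ c · (x · x + y · y)
  offDiagonal-bound {a} x y a≤c with d , refl ← ℕP.m≤n⇒∃[o]m+o≡n a≤c =
    subst (0r ≤_) (sym sum-of-squares)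
      (+-nonneg (*-nonneg (fromℕ-nonneg a) (x·x-nonneg (x + y)))
                (*-nonneg (fromℕ-nonneg d) (+-nonneg (x·x-nonneg x) (x·x-nonneg y))))
    where
    sum-of-squares : (x · fromℕ a · y + x · fromℕ a · y) + fromℕ (a ℕ.+ d) · (x · x + y · y)
                   ≡ fromℕ a · ((x + y) · (x + y)) + fromℕ d · (x · x + y · y)
    sum-of-squares = trans (cong (λ c → (x · fromℕ a · y + x · fromℕ a · y) + c · (x · x + y · y)) (fromℕ-+ a d))
      (solve 4 (λ x y a d → (x :* a :* y :+ x :* a :* y) :+ (a :+ d) :* (x :* x :+ y :* y)
                          := a :* ((x :+ y) :* (x :+ y)) :+ d :* (x :* x :+ y :* y)) refl x y (fromℕ a) (fromℕ d))

  diagonal-bound : ∀ {a b} c x → b ℕ.≤ a →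
    ((fromℕ b + fromℕ b) + (fromℕ c + fromℕ c)) · (x · x) ≤ (x · fromℕ a · x + x · fromℕ a · x) + fromℕ c · (x · x + x · x)
  diagonal-bound {b = b} c x b≤a with e , refl ← ℕP.m≤n⇒∃[o]m+o≡n b≤a =
    subst (((fromℕ b + fromℕ b) + (fromℕ c + fromℕ c)) · (x · x) ≤_) (sym excess) (≤-+ʳ _ (+-nonneg e·x·x-nonneg e·x·x-nonneg))
    where
    e·x·x-nonneg : 0r ≤ fromℕ e · (x · x)
    e·x·x-nonneg = *-nonneg (fromℕ-nonneg e) (x·x-nonneg x)
    excess : (x · fromℕ (b ℕ.+ e) · x + x · fromℕ (b ℕ.+ e) · x) + fromℕ c · (x · x + x · x)
           ≡ ((fromℕ b + fromℕ b) + (fromℕ c + fromℕ c)) · (x · x) + (fromℕ e · (x · x) + fromℕ e · (x · x))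
    excess = trans (cong (λ a → (x · a · x + x · a · x) + fromℕ c · (x · x + x · x)) (fromℕ-+ b e))
      (solve 4 (λ x b e c → (x :* (b :+ e) :* x :+ x :* (b :+ e) :* x) :+ c :* (x :* x :+ x :* x)
                          := ((b :+ b) :+ (c :+ c)) :* (x :* x) :+ (e :* (x :* x) :+ e :* (x :* x)))
             refl x (fromℕ b) (fromℕ e) (fromℕ c))

  -- Pairing xᵢ Nᵢⱼ xⱼ with c (xᵢ² + xⱼ²) and summing gives 2Q + 2ncS ≥ (2(nc + 1) + 2c) S,
  -- where Q is the quadratic form and S = Σ xᵢ².
  diagonallyDominant⇒positiveDefinite : ∀ {n} (N : Mat ℕ n) (c : ℕ) →
    (∀ i j → i ≢ j → N i j ℕ.≤ c) → (∀ i → n ℕ.* c ℕ.+ 1 ℕ.≤ N i i) → PositiveDefinite (real N)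
  diagonallyDominant⇒positiveDefinite {n} N c off-≤ diag-≥ x x≢0 =
    x+x-pos⇒pos (<-≤-trans W-pos (+-cancelʳ-≤ (R + R) (subst₂ _≤_ (+-comm (R + R) W) refl bound)))
    where
    C A S Q R W : Carrier
    C = fromℕ c
    A = fromℕ (n ℕ.* c ℕ.+ 1)
    S = Σ[ (λ i → x i · x i) ]
    Q = quad (real N) x
    R = fromℕ n · (C · S)
    W = ((1r + 1r) + (C + C)) · S

    q h : Fin n → Fin n → Carrier
    q i j = x i · fromℕ (N i j) · x j
    h i j = (q i j + q i j) + C · (x i · x i + x j · x j)

    δ≤h : ∀ i j → δ i j (((A + A) + (C + C)) · (x i · x i)) ≤ h i j
    δ≤h i j with i ≟ j
    ... | yes refl = diagonal-bound c (x i) (diag-≥ i)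
    ... | no i≢j   = offDiagonal-bound (x i) (x j) (off-≤ i j i≢j)

    A≡nC+1 : A ≡ fromℕ n · C + 1r
    A≡nC+1 = trans (fromℕ-+ (n ℕ.* c) 1) (cong₂ _+_ (fromℕ-* n c) (+-identityʳ 1r))

    Σδ : Σ[ (λ i → Σ[ (λ j → δ i j (((A + A) + (C + C)) · (x i · x i))) ]) ] ≡ (R + R) + W
    Σδ = begin
      Σ[ (λ i → Σ[ (λ j → δ i j (((A + A) + (C + C)) · (x i · x i))) ]) ]
        ≡⟨ Σ-cong {n} (λ i → Σ-δ i _) ⟩
      Σ[ (λ i → ((A + A) + (C + C)) · (x i · x i)) ]
        ≡⟨ Σ-*ˡ ((A + A) + (C + C)) (λ i → x i · x i) ⟩
      ((A + A) + (C + C)) · S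
        ≡⟨ cong (λ a → ((a + a) + (C + C)) · S) A≡nC+1 ⟩
      (((fromℕ n · C + 1r) + (fromℕ n · C + 1r)) + (C + C)) · S
        ≡⟨ solve 3 (λ m c s → (((m :* c :+ con 1) :+ (m :* c :+ con 1)) :+ (c :+ c)) :* s
                           := (m :* (c :* s) :+ m :* (c :* s)) :+ ((con 1 :+ con 1) :+ (c :+ c)) :* s)
                 refl (fromℕ n) C S ⟩
      (R + R) + W
        ∎
      where open ≡-Reasoning

    row : ∀ i → Σ[ h i ] ≡ (Σ[ q i ] + Σ[ q i ]) + (fromℕ n · (C · (x i · x i)) + C · S)
    row i = trans (Σ-+ (λ j → q i j + q i j) (λ j → C · (x i · x i + x j · x j)))
      (cong₂ _+_ (Σ-+ (q i) (q i))
        (trans (Σ-cong λ j → distribˡ C (x i · x i) (x j · x j))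
          (trans (Σ-+ (λ _ → C · (x i · x i)) (λ j → C · (x j · x j)))
            (cong₂ _+_ (Σ-const {n} (C · (x i · x i))) (Σ-*ˡ C λ j → x j · x j)))))

    Σh : Σ[ (λ i → Σ[ h i ]) ] ≡ (Q + Q) + (R + R)
    Σh = begin
      Σ[ (λ i → Σ[ h i ]) ]
        ≡⟨ Σ-cong row ⟩
      Σ[ (λ i → (Σ[ q i ] + Σ[ q i ]) + (fromℕ n · (C · (x i · x i)) + C · S)) ]
        ≡⟨ Σ-+ (λ i → Σ[ q i ] + Σ[ q i ]) (λ i → fromℕ n · (C · (x i · x i)) + C · S) ⟩
      Σ[ (λ i → Σ[ q i ] + Σ[ q i ]) ] + Σ[ (λ i → fromℕ n · (C · (x i · x i)) + C · S) ]
        ≡⟨ cong₂ _+_ (Σ-+ (λ i → Σ[ q i ]) (λ i → Σ[ q i ])) (Σ-+ (λ i → fromℕ n · (C · (x i · x i))) (λ _ → C · S)) ⟩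
      (Q + Q) + (Σ[ (λ i → fromℕ n · (C · (x i · x i))) ] + Σ[ (λ (_ : Fin n) → C · S) ])
        ≡⟨ cong ((Q + Q) +_) (cong₂ _+_ (trans (Σ-*ˡ (fromℕ n) λ i → C · (x i · x i)) (cong (fromℕ n ·_) (Σ-*ˡ C λ i → x i · x i))) (Σ-const {n} (C · S))) ⟩
      (Q + Q) + (R + R)
        ∎
      where open ≡-Reasoning

    bound : (R + R) + W ≤ (Q + Q) + (R + R)
    bound = subst₂ _≤_ Σδ Σh (Σ-mono λ i → Σ-mono (δ≤h i))

    W-pos : 0r < W
    W-pos = ·-pos
      (subst (_< (1r + 1r) + (C + C)) (+-identityʳ 0r)
        (+-mono-<-≤ (subst (_< 1r + 1r) (+-identityʳ 0r) (+-mono-<-≤ 0<1 (inj₁ 0<1)))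
                    (+-nonneg (fromℕ-nonneg c) (fromℕ-nonneg c))))
      (Σ-squares-pos x x≢0)

  real-samePattern : ∀ {n} (X : Mat ℕ n) → SamePattern (real X) X
  real-samePattern X i j r s = mk⇔ fromℕ-injective (cong fromℕ)

  SymSub-positiveDefinite : ∀ {n} (S : Mat Str n) → PositiveDefinite (real (SymSub S))
  SymSub-positiveDefinite S =
    diagonallyDominant⇒positiveDefinite (SymSub S) _ (SymSub-offDiagonal-≤ S) (SymSub-diagonal-≥ S)

open import Data.Nat using (_*_; _+_; _≤_)

theorem19 : (ℝ : RealField) → (m : ℕ) → (C : Mat ℕ m) → ValidC C →
    let open RealField ℝ using (Carrier)
        open RealMatrices ℝ
        M = PCM C
    in Symmetric M → PositiveDefinite (real M) →
       ((i : ℕ) → 1 ≤ i → In𝕄 M (real (iter M i)))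
       × ((s : ℕ) → ((j : ℕ) → 1 ≤ j → SamePattern (iter M (s + j)) (iter M s)) →
          (Mstar : Mat Carrier (m * m)) → SymPD Mstar → SamePattern Mstar (iter M s) →
          In𝕄 M Mstar)
theorem19 ℝ m C _ sym-M _ = iterates-in-𝕄 , pattern-in-𝕄
  where
  open RealField ℝ using (Carrier)
  open RealMatrices ℝ
  open RealFieldProperties ℝ using (real-samePattern; SymSub-positiveDefinite)

  M : Mat ℕ (m * m)
  M = PCM C

  iter-sameAut-real : ∀ k → SameAut (iter M k) (real M)
  iter-sameAut-real k =
    SameAut-trans (iter-sameAut M sym-M k) (SamePattern⇒SameAut (SamePattern-sym (real-samePattern M)))

  iterates-in-𝕄 : (i : ℕ) → 1 ≤ i → In𝕄 M (real (iter M i))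
  iterates-in-𝕄 (suc k) _ =
    ((λ i j → cong fromℕ (iter-symmetric M sym-M (suc k) i j)) , SymSub-positiveDefinite (SymSqr (iter M k))) ,
    SameAut-trans (SamePattern⇒SameAut (real-samePattern (iter M (suc k)))) (iter-sameAut-real (suc k))

  pattern-in-𝕄 : (s : ℕ) → ((j : ℕ) → 1 ≤ j → SamePattern (iter M (s + j)) (iter M s)) →
                 (Mstar : Mat Carrier (m * m)) → SymPD Mstar → SamePattern Mstar (iter M s) → In𝕄 M Mstar
  pattern-in-𝕄 s _ Mstar Mstar-SymPD Mstar≈M⁽ˢ⁾ =
    Mstar-SymPD , SameAut-trans (SamePattern⇒SameAut Mstar≈M⁽ˢ⁾) (iter-sameAut-real s)
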